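{- For every $n\ge 1$ and every even $k\ge 2$, every $n$-point path admits a shortcutting with hop-diameter $k$ and arboricity $O(\alpha_{k/2+1}(n))$.
   Context: A shortcutting of a tree $T=(V,E)$ with hop-diameter $k$ is a graph $G=(V,E')$, each edge $(x,y)$ having length $d_T(x,y)$ (the tree distance), such that for all $u,v\in V$ there is a $u$–$v$ path in $G$ with at most $k$ edges and length exactly $d_T(u,v)$. Arboricity of $G$: $\max_{H\subseteq G,|V(H)|\ge2}\lceil |E(H)|/(|V(H)|-1)\rceil$. Ackermann functions: $A(0,n)=2n$; for $k\ge1$, $A(k,0)=1$ and $A(k,n)=A(k-1,A(k,n-1))$ for $n\ge1$; $B(0,n)=n^2$; for $k\ge1$, $B(k,0)=2$ and $B(k,n)=B(k-1,B(k,n-1))$ for $n\ge1$. Inverse Ackermann: $\alpha_{2k}(n)=\min\{s\ge0: A(k,s)\ge n\}$ and $\alpha_{2k+1}(n)=\min\{s\ge0:B(k,s)\ge n\}$ (so $\alpha_2(n)=\lceil\log n\rceil$, $\alpha_3(n)=\lceil\log\log n\rceil$, $\alpha_4(n)=\log^* n$). -}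

module Defs where

open import Data.Nat using (ℕ; zero; suc; _+_; _*_; _∸_; _≤_; _<_; ∣_-_∣; ⌊_/2⌋)
open import Data.Nat.DivMod using (_/_; _%_)
open import Data.Bool using (Bool; true; false)
open import Data.Fin using (Fin; toℕ)
open import Data.Fin.Subset using (Subset; _∈_; ∣_∣)
open import Data.Product using (Σ; _×_)
open import Relation.Binary.PropositionalEquality using (_≡_)
open import Relation.Nullary using (¬_; yes; no)
open import Data.Nat using (_<?_)

A : ℕ → ℕ → ℕ
A zero n = 2 * n
A (suc k) zero = 1
A (suc k) (suc n) = A k (A (suc k) n)

B : ℕ → ℕ → ℕ
B zero n = n * n
B (suc k) zero = 2
B (suc k) (suc n) = B k (B (suc k) n)

Grow : ℕ → ℕ → ℕ
Grow m s with m % 2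
... | zero  = A ⌊ m /2⌋ s
... | suc _ = B ⌊ m /2⌋ s

IsAlpha : ℕ → ℕ → ℕ → Set
IsAlpha m n s = (n ≤ Grow m s) × (∀ t → t < s → ¬ (n ≤ Grow m t))

Graph : ℕ → Set
Graph n = Fin n → Fin n → Bool

SymmetricG : ∀ {n} → Graph n → Set
SymmetricG {n} E = ∀ (i j : Fin n) → E i j ≡ E j i

IrreflexiveG : ∀ {n} → Graph n → Set
IrreflexiveG {n} E = ∀ (i : Fin n) → E i i ≡ false

-- Tree distance in the n-point path 0 - 1 - ... - (n-1).
dist : ∀ {n} → Fin n → Fin n → ℕ
dist i j = ∣ toℕ i - toℕ j ∣

data Walk {n} (E : Graph n) : Fin n → Fin n → Set where
  here : ∀ {u} → Walk E u u
  step : ∀ {u w v} → E u w ≡ true → Walk E w v → Walk E u v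

hops : ∀ {n} {E : Graph n} {u v} → Walk E u v → ℕ
hops here = 0
hops (step _ p) = suc (hops p)

walkLength : ∀ {n} {E : Graph n} {u v} → Walk E u v → ℕ
walkLength here = 0
walkLength (step {u} {w} _ p) = dist u w + walkLength p

HopDiameter≤ : ∀ {n} → Graph n → ℕ → Set
HopDiameter≤ {n} E k =
  ∀ (u v : Fin n) → Σ (Walk E u v) (λ p → (hops p ≤ k) × (walkLength p ≡ dist u v))

IsShortcutting : ∀ {n} → Graph n → ℕ → Set
IsShortcutting E k = SymmetricG E × IrreflexiveG E × HopDiameter≤ E k

sumFin : ∀ n → (Fin n → ℕ) → ℕ
sumFin zero f = 0
sumFin (suc n) f = f Fin.zero + sumFin n (λ i → f (Fin.suc i))
  where import Data.Fin as Fin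

bool→ℕ : Bool → ℕ
bool→ℕ true = 1
bool→ℕ false = 0

edgeCount : ∀ {n} → Graph n → ℕ
edgeCount {n} F = sumFin n λ i → sumFin n λ j → lt i j
  where
  lt : Fin n → Fin n → ℕ
  lt i j with toℕ i <? toℕ j
  ... | yes _ = bool→ℕ (F i j)
  ... | no _  = 0

IsSubgraph : ∀ {n} → Graph n → Subset n → Graph n → Set
IsSubgraph {n} E S F =
  SymmetricG F × (∀ (i j : Fin n) → F i j ≡ true → (E i j ≡ true) × (i ∈ S) × (j ∈ S))

-- ⌈ a / d ⌉ for d ≥ 1 (unused value 0 when d = 0).
ceilDiv : ℕ → ℕ → ℕ
ceilDiv a zero = 0
ceilDiv a (suc d) = (a + d) / suc d

Arboricity≤ : ∀ {n} → Graph n → ℕ → Set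
Arboricity≤ {n} E b =
  ∀ (S : Subset n) (F : Graph n) → IsSubgraph E S F → 2 ≤ ∣ S ∣ →
  ceilDiv (edgeCount F) (∣ S ∣ ∸ 1) ≤ b

{-# OPTIONS --safe #-}
-- Cut the path into a hierarchy of blocks: level-l blocks have span j l + 1 points and each
-- level-(l+1) block is a row of capacity j (2 * span j l) + 2 level-l blocks.  Every point gets,
-- for each level l < S, an edge to the end of its level-l block and one to the end of the
-- preceding level-l block.  To go from a to b > a, take the level l at which a and b first lie
-- inside a common level-(l+1) block: jump from a to the end of its level-l block, travel along
-- the ends of the level-l blocks in between, and jump on to b.  Those block ends form a path of
-- at most capacity j (2 * span j l) + 1 points whose gaps contain the interior points of the
-- level-l blocks; using them as helpers (two per point), this path is shortcut recursively with
-- hop-diameter 2j, which costs each point two more edges per level.  Hence the hop-diameter is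
-- 1 + 2j + 1, each point owns at most 6S edges, and the arboricity is at most 24S; the walks are
-- monotone along the path, so their lengths are exact distances.
-- In the recursion with hop-diameter 2(j+2), the m helpers of a gap provide m / 4 jumps to
-- block ends, m / 4 jumps back and two helpers per level for the subpaths, so span j (m / 4)
-- points are covered: span (j + 2) iterates span j.  Thus span j outgrows A (j / 2 + 1) for
-- even j and B ((j + 1) / 2) for odd j, and S = α_{k/2+1}(n) + 4 levels suffice.
module Submission where

open import Defs
open import Data.Nat using (ℕ; _+_; _*_; _≤_; suc)
open import Data.Nat.DivMod using (_/_; _%_)
open import Data.Product using (Σ; _×_)
open import Relation.Binary.PropositionalEquality using (_≡_)

open import Data.Nat
open import Data.Nat.Properties
open import Data.Nat.DivMod
open import Data.Nat.Divisibility using (divides)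
open import Data.Nat.Tactic.RingSolver using (solve-∀)
open import Data.Bool using (true; false; _∨_)
open import Data.Bool.Properties using (T-≡)
open import Data.Fin using (Fin; toℕ; fromℕ<) renaming (zero to fzero; suc to fsuc)
open import Data.Fin.Properties using (toℕ-injective; toℕ-fromℕ<; toℕ<n)
open import Data.Fin.Subset using (Subset; ∣_∣) renaming (_∈_ to _∈ˢ_)
open import Data.Vec using (_∷_; []; lookup)
open import Data.Vec.Properties using ([]=⇒lookup)
open import Data.Product using (Σ; ∃-syntax; _×_; _,_; proj₁; proj₂)
open import Data.Sum using (_⊎_; inj₁; inj₂; swap)
open import Data.Empty using (⊥-elim)
open import Data.List using (List; []; _∷_; length; _++_)
open import Data.List.Properties using (length-++)
open import Data.List.Membership.DecPropositional _≟_ using (_∈_; _∈?_)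
open import Data.List.Membership.Propositional.Properties using (∈-++⁺ˡ; ∈-++⁺ʳ)
open import Data.List.Relation.Unary.Any using (here; there)
open import Function using (_∘_; id; const; mk⇔; Equivalence)
open import Relation.Nullary using (¬_; Dec; does; yes; no; contradiction)
open import Relation.Nullary.Decidable using (_×-dec_; _⊎-dec_; ¬?; dec-true; dec-false; does-⇔; toWitness; isYes≗does)
open import Relation.Unary using (Decidable)
open import Relation.Binary.PropositionalEquality
open import Algebra.Properties.Semiring.Sum +-*-semiring
  using (sum-syntax; sum-cong-≗; ∑-distrib-+; ∑-comm; *-distribˡ-sum; *-distribʳ-sum; sum-replicate-zero)

[m+kn]%n≡m : ∀ {m} k n .{{_ : NonZero n}} → m < n → (m + k * n) % n ≡ m
[m+kn]%n≡m {m} k n m<n = trans ([m+kn]%n≡m%n m k n) (m<n⇒m%n≡m m<n)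

[m+kn]/n≡k : ∀ {m} k n .{{_ : NonZero n}} → m < n → (m + k * n) / n ≡ k
[m+kn]/n≡k {m} k n m<n = sym (*-cancelʳ-≡ k _ n (+-cancelˡ-≡ m _ _ (begin
  m + k * n                             ≡⟨ m≡m%n+[m/n]*n (m + k * n) n ⟩
  (m + k * n) % n + (m + k * n) / n * n  ≡⟨ cong (_+ (m + k * n) / n * n) ([m+kn]%n≡m k n m<n) ⟩
  m + (m + k * n) / n * n                ∎)))
  where open ≡-Reasoning

halve-2l+c : ∀ l {c} → c < 2 → (2 * l + c) / 2 ≡ l × (2 * l + c) % 2 ≡ c
halve-2l+c l {c} c<2 = trans (cong (_/ 2) 2l+c≡) ([m+kn]/n≡k l 2 c<2) , trans (cong (_% 2) 2l+c≡) ([m+kn]%n≡m l 2 c<2)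
  where
  2l+c≡ : 2 * l + c ≡ c + l * 2
  2l+c≡ = trans (+-comm (2 * l) c) (cong (c +_) (*-comm 2 l))

turns-on : ∀ {P : ℕ → Set} → Decidable P → ¬ P 0 → ∀ {L} → P L →
           ∃[ l ] l < L × ¬ P l × P (suc l)
turns-on P? ¬P₀ {zero}  P₀ = ⊥-elim (¬P₀ P₀)
turns-on P? ¬P₀ {suc L} P₁₊L with P? L
... | no ¬Pₗ = L , ≤-refl , ¬Pₗ , P₁₊L
... | yes Pₗ with turns-on P? ¬P₀ Pₗ
...   | l , l<L , switch = l , m<n⇒m<1+n l<L , switch

module Ascents (Adj : ℕ → ℕ → Set) where

  data Ascent : ℕ → ℕ → ℕ → Set where
    stay : ∀ {h x} → Ascent h x x
    step : ∀ {h x y z} → x < y → Adj x y → Ascent h y z → Ascent (suc h) x z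

  weaken : ∀ {h h′ x y} → h ≤ h′ → Ascent h x y → Ascent h′ x y
  weaken _       stay           = stay
  weaken (s≤s p) (step x<y a r) = step x<y a (weaken p r)

  infixr 5 _++ᴬ_
  _++ᴬ_ : ∀ {h₁ h₂ x y z} → Ascent h₁ x y → Ascent h₂ y z → Ascent (h₁ + h₂) x z
  _++ᴬ_ {h₁} {h₂} stay r = weaken (m≤n+m h₂ h₁) r
  step x<y a r ++ᴬ r′     = step x<y a (r ++ᴬ r′)

  edge : ∀ {x y} → x < y → Adj x y → Ascent 1 x y
  edge x<y a = step x<y a stay

  ascent⇒≤ : ∀ {h x y} → Ascent h x y → x ≤ y
  ascent⇒≤ stay           = ≤-refl
  ascent⇒≤ (step x<y _ r) = ≤-trans (<⇒≤ x<y) (ascent⇒≤ r)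

-- Level-l blocks are the intervals of length suc (p l) starting at multiples of suc (p l).
module Blocks (p : ℕ → ℕ) where

  size : ℕ → ℕ
  size l = suc (p l)

  IsEnd : ℕ → ℕ → Set
  IsEnd l x = x % size l ≡ p l

  end : ℕ → ℕ → ℕ
  end l a = a + (p l ∸ a % size l)

  prevEnd : ℕ → ℕ → ℕ
  prevEnd l b = b ∸ suc (b % size l)

  -- the end of the i-th level-l block inside the B-th level-(suc l) block
  subEnd : ℕ → ℕ → ℕ → ℕ
  subEnd B l i = B * size (suc l) + i * size l + p l

  subEnd-+ : ∀ B l i r → B * size (suc l) + suc i * size l + r ≡ subEnd B l i + suc r
  subEnd-+ B l i r = ring (B * size (suc l)) i (p l) r
    where
    ring : ∀ c i q r → c + suc i * suc q + r ≡ (c + i * suc q + q) + suc r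
    ring = solve-∀

  <-end : ∀ l a → ¬ IsEnd l a → a < end l a
  <-end l a not-end = subst (_< end l a) (+-identityʳ a)
    (+-monoʳ-< a (m<n⇒0<n∸m (≤∧≢⇒< (≤-pred (m%n<n a (size l))) not-end)))

  prevEnd≤ : ∀ l b → prevEnd l b ≤ b
  prevEnd≤ l b = m∸n≤m b (suc (b % size l))

  subEnd-mono-≤ : ∀ B l {i i′} → i ≤ i′ → subEnd B l i ≤ subEnd B l i′
  subEnd-mono-≤ B l i≤i′ = +-monoˡ-≤ (p l) (+-monoʳ-≤ (B * size (suc l)) (*-monoˡ-≤ (size l) i≤i′))

  subEnd-mono-< : ∀ B l {i i′} → i < i′ → subEnd B l i < subEnd B l i′
  subEnd-mono-< B l i<i′ = +-monoˡ-< (p l) (+-monoʳ-< (B * size (suc l)) (*-monoˡ-< (size l) i<i′))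

module Hierarchy (p M : ℕ → ℕ) (size-suc : ∀ l → suc (p (suc l)) ≡ (M l + 2) * suc (p l)) where

  open Blocks p

  regroup : ∀ l B i q → B * size (suc l) + i * size l + q ≡ q + (B * (M l + 2) + i) * size l
  regroup l B i q = trans (cong (λ t → B * t + i * size l + q) (size-suc l)) (ring B (M l + 2) (size l) i q)
    where
    ring : ∀ b m s a r → b * (m * s) + a * s + r ≡ r + (b * m + a) * s
    ring = solve-∀

  module Digits (l x : ℕ) where
    open ≡-Reasoning

    hi mid lo : ℕ
    hi  = x / size (suc l)
    mid = x % size (suc l) / size l
    lo  = x % size l

    %-digits : x % size (suc l) ≡ mid * size l + lo
    %-digits = begin
      x % size (suc l)                         ≡⟨ m≡m%n+[m/n]*n _ (size l) ⟩
      x % size (suc l) % size l + mid * size l  ≡⟨ cong (_+ mid * size l) low ⟩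
      lo + mid * size l                         ≡⟨ +-comm lo _ ⟩
      mid * size l + lo                         ∎
      where
      low : x % size (suc l) % size l ≡ lo
      low = m∣n⇒o%n%m≡o%m (size l) (size (suc l)) x (divides (M l + 2) (size-suc l))

    digits : x ≡ hi * size (suc l) + mid * size l + lo
    digits = begin
      x                                        ≡⟨ m≡m%n+[m/n]*n x (size (suc l)) ⟩
      x % size (suc l) + hi * size (suc l)      ≡⟨ +-comm _ (hi * size (suc l)) ⟩
      hi * size (suc l) + x % size (suc l)      ≡⟨ cong (hi * size (suc l) +_) %-digits ⟩
      hi * size (suc l) + (mid * size l + lo)   ≡⟨ +-assoc (hi * size (suc l)) _ lo ⟨
      hi * size (suc l) + mid * size l + lo     ∎

    mid<M+2 : mid < M l + 2
    mid<M+2 = m<n*o⇒m/o<n (subst (x % size (suc l) <_) (size-suc l) (m%n<n x (size (suc l))))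

    lo≤p : lo ≤ p l
    lo≤p = ≤-pred (m%n<n x (size l))

    end≡subEnd : end l x ≡ subEnd hi l mid
    end≡subEnd = begin
      x + (p l ∸ lo)                                        ≡⟨ cong (_+ (p l ∸ lo)) digits ⟩
      hi * size (suc l) + mid * size l + lo + (p l ∸ lo)     ≡⟨ +-assoc _ lo (p l ∸ lo) ⟩
      hi * size (suc l) + mid * size l + (lo + (p l ∸ lo))
        ≡⟨ cong (hi * size (suc l) + mid * size l +_) (m+[n∸m]≡n lo≤p) ⟩
      subEnd hi l mid                                        ∎

    prevEnd≡subEnd : ∀ {i} → mid ≡ suc i → prevEnd l x ≡ subEnd hi l i
    prevEnd≡subEnd {i} mid≡1+i = begin
      x ∸ suc lo                                           ≡⟨ cong (_∸ suc lo) digits ⟩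
      hi * size (suc l) + mid * size l + lo ∸ suc lo
        ≡⟨ cong (λ t → hi * size (suc l) + t * size l + lo ∸ suc lo) mid≡1+i ⟩
      hi * size (suc l) + suc i * size l + lo ∸ suc lo      ≡⟨ cong (_∸ suc lo) (subEnd-+ hi l i lo) ⟩
      subEnd hi l i + suc lo ∸ suc lo                       ≡⟨ m+n∸n≡m (subEnd hi l i) (suc lo) ⟩
      subEnd hi l i                                        ∎

    /size : x / size l ≡ hi * (M l + 2) + mid
    /size = begin
      x / size l                                       ≡⟨ cong (_/ size l) (trans digits (regroup l hi mid lo)) ⟩
      (lo + (hi * (M l + 2) + mid) * size l) / size l  ≡⟨ [m+kn]/n≡k (hi * (M l + 2) + mid) (size l) (m%n<n x (size l)) ⟩
      hi * (M l + 2) + mid                              ∎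

  digits-of : ∀ {l} B {i q} → i < M l + 2 → q < size l →
              let x = B * size (suc l) + i * size l + q in
              Digits.hi l x ≡ B × Digits.mid l x ≡ i × Digits.lo l x ≡ q
  digits-of {l} B {i} {q} i<M+2 q<size =
    trans (cong (_/ size (suc l)) x≡) ([m+kn]/n≡k B (size (suc l)) inner<) ,
    trans (cong (λ t → t % size (suc l) / size l) x≡)
          (trans (cong (_/ size l) ([m+kn]%n≡m B (size (suc l)) inner<))
                 (trans (cong (_/ size l) (+-comm (i * size l) q)) ([m+kn]/n≡k i (size l) q<size))) ,
    trans (cong (_% size l) (regroup l B i q)) ([m+kn]%n≡m (B * (M l + 2) + i) (size l) q<size)
    where
    x≡ : B * size (suc l) + i * size l + q ≡ (i * size l + q) + B * size (suc l)
    x≡ = trans (+-assoc (B * size (suc l)) _ q) (+-comm (B * size (suc l)) _)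
    inner< : i * size l + q < size (suc l)
    inner< = begin-strict
      i * size l + q      <⟨ +-monoʳ-< (i * size l) q<size ⟩
      i * size l + size l ≡⟨ +-comm (i * size l) (size l) ⟩
      suc i * size l      ≤⟨ *-monoˡ-≤ (size l) (subst (suc i ≤_) (+-comm (M l) 2) i<M+2) ⟩
      (2 + M l) * size l  ≡⟨ cong (_* size l) (+-comm 2 (M l)) ⟩
      (M l + 2) * size l  ≡⟨ size-suc l ⟨
      size (suc l)        ∎
      where open ≤-Reasoning


module Routing (Adj : ℕ → ℕ → Set) (p M : ℕ → ℕ) (p₀≡1 : p 0 ≡ 1)
               (size-suc : ∀ l → suc (p (suc l)) ≡ (M l + 2) * suc (p l)) where

  open Ascents Adj
  open Blocks p
  open Hierarchy p M size-suc

  SameInterior : ℕ → ℕ → ℕ → Set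
  SameInterior l a b = (a / size l ≡ b / size l) × ¬ IsEnd l a × ¬ IsEnd l b

  sameInterior? : ∀ a b → Decidable (λ l → SameInterior l a b)
  sameInterior? a b l =
    (a / size l ≟ b / size l) ×-dec ¬? (a % size l ≟ p l) ×-dec ¬? (b % size l ≟ p l)

  ¬sameInterior₀ : ∀ {a b} → a < b → ¬ SameInterior 0 a b
  ¬sameInterior₀ {a} {b} a<b same = <-irrefl (even≡ same′) a<b
    where
    same′ : (a / 2 ≡ b / 2) × a % 2 ≢ 1 × b % 2 ≢ 1
    same′ = subst (λ q → (a / suc q ≡ b / suc q) × a % suc q ≢ q × b % suc q ≢ q) p₀≡1 same
    even : ∀ x → x % 2 ≢ 1 → x ≡ x / 2 * 2
    even x odd with x % 2 | m%n<n x 2 | m≡m%n+[m/n]*n x 2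
    ... | 0 | _ | x≡ = x≡
    ... | 1 | _ | _  = ⊥-elim (odd refl)
    ... | suc (suc _) | s≤s (s≤s ()) | _
    even≡ : (a / 2 ≡ b / 2) × a % 2 ≢ 1 × b % 2 ≢ 1 → a ≡ b
    even≡ (eq , a-even , b-even) = trans (even a a-even) (trans (cong (_* 2) eq) (sym (even b b-even)))

  sameInterior-below : ∀ {a b L} → a ≤ b → b < p L → SameInterior L a b
  sameInterior-below {a} {b} {L} a≤b b<p = trans (first a<p) (sym (first b<p)) , not-end a<p , not-end b<p
    where
    a<p : a < p L
    a<p = ≤-<-trans a≤b b<p
    first : ∀ {x} → x < p L → x / size L ≡ 0
    first x<p = m<n⇒m/n≡0 (m<n⇒m<1+n x<p)
    not-end : ∀ {x} → x < p L → ¬ IsEnd L x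
    not-end {x} x<p x-end = <-irrefl (trans (sym (m<n⇒m%n≡m (m<n⇒m<1+n x<p))) x-end) x<p

  module Route (τ : ℕ → ℕ) (L K e h : ℕ) (K<p : K < p L)
    (to-end       : ∀ l a → l < L → ¬ IsEnd l a → end l a ≤ K → Ascent e (τ a) (τ (end l a)))
    (from-prevEnd : ∀ l b → l < L → ¬ IsEnd l b → b ≤ K → Ascent e (τ (prevEnd l b)) (τ b))
    (along-ends   : ∀ l B i i′ → l < L → i ≤ i′ → i′ ≤ M l → subEnd B l i′ ≤ K →
                    Ascent h (τ (subEnd B l i)) (τ (subEnd B l i′)))
    where

    castᴬ : ∀ {k x x′ y y′} → x ≡ x′ → y ≡ y′ → Ascent k (τ x) (τ y) → Ascent k (τ x′) (τ y′)
    castᴬ {k} x≡x′ y≡y′ = subst₂ (λ u v → Ascent k (τ u) (τ v)) x≡x′ y≡y′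

    module AtLevel {a b l : ℕ} (a<b : a < b) (b≤K : b ≤ K) (l<L : l < L)
                   (¬same : ¬ SameInterior l a b) (same : SameInterior (suc l) a b) where

      module Dₐ = Digits l a
      module D_b = Digits l b

      block : ℕ
      block = D_b.hi

      hi-eq : Dₐ.hi ≡ block
      hi-eq = proj₁ same

      a-digits : a ≡ block * size (suc l) + Dₐ.mid * size l + Dₐ.lo
      a-digits = trans Dₐ.digits (cong (λ t → t * size (suc l) + Dₐ.mid * size l + Dₐ.lo) hi-eq)

      mid-mono : Dₐ.mid ≤ D_b.mid
      mid-mono = /-monoˡ-≤ (size l) (+-cancelʳ-≤ (block * size (suc l)) _ _
                   (subst₂ _≤_ a≡ (m≡m%n+[m/n]*n b (size (suc l))) (<⇒≤ a<b)))
        where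
        a≡ : a ≡ a % size (suc l) + block * size (suc l)
        a≡ = trans (m≡m%n+[m/n]*n a (size (suc l))) (cong (λ t → a % size (suc l) + t * size (suc l)) hi-eq)

      end≡subEnd : end l a ≡ subEnd block l Dₐ.mid
      end≡subEnd = trans Dₐ.end≡subEnd (cong (λ t → subEnd t l Dₐ.mid) hi-eq)

      to-subEnd : ∀ {i} → Dₐ.mid ≤ i → subEnd block l i ≤ K → Ascent e (τ a) (τ (subEnd block l Dₐ.mid))
      to-subEnd {i} mid≤i sub≤K with a % size l ≟ p l
      ... | yes a-end = castᴬ refl (trans a≡end end≡subEnd) stay
        where
        a≡end : a ≡ end l a
        a≡end = sym (trans (cong (λ t → a + (p l ∸ t)) a-end) (trans (cong (a +_) (n∸n≡0 (p l))) (+-identityʳ a)))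
      ... | no a-not-end =
        castᴬ refl end≡subEnd (to-end l a l<L a-not-end
          (subst (_≤ K) (sym end≡subEnd) (≤-trans (subEnd-mono-≤ block l mid≤i) sub≤K)))

      ascent-from-end : IsEnd l b → Ascent (e + h + e) (τ a) (τ b)
      ascent-from-end b-end =
        (to-subEnd mid-mono sub≤K ++ᴬ along-ends l block Dₐ.mid D_b.mid l<L mid-mono mid≤M sub≤K)
        ++ᴬ castᴬ refl b≡ stay
        where
        b≡ : subEnd block l D_b.mid ≡ b
        b≡ = sym (trans D_b.digits (cong (block * size (suc l) + D_b.mid * size l +_) b-end))
        sub≤K : subEnd block l D_b.mid ≤ K
        sub≤K = subst (_≤ K) (sym b≡) b≤K
        mid≢M+1 : D_b.mid ≢ suc (M l)
        mid≢M+1 mid≡ = proj₂ (proj₂ same) (suc-injective (begin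
          suc (b % size (suc l))                    ≡⟨ cong suc D_b.%-digits ⟩
          suc (D_b.mid * size l + D_b.lo)            ≡⟨ cong₂ (λ u v → suc (u * size l + v)) mid≡ b-end ⟩
          suc (suc (M l) * size l + p l)             ≡⟨ top (M l) (p l) ⟩
          (M l + 2) * size l                         ≡⟨ size-suc l ⟨
          suc (p (suc l))                            ∎))
          where
          open ≡-Reasoning
          top : ∀ m q → suc (suc m * suc q + q) ≡ (m + 2) * suc q
          top = solve-∀
        mid≤M : D_b.mid ≤ M l
        mid≤M = ≤-pred (≤∧≢⇒< (≤-pred (subst (D_b.mid <_) (+-comm (M l) 2) D_b.mid<M+2)) mid≢M+1)

      mids-differ : ¬ IsEnd l b → Dₐ.mid ≢ D_b.mid
      mids-differ b-not-end mids≡ with a % size l ≟ p l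
      ... | no a-not-end = ¬same (same-block , a-not-end , b-not-end)
        where
        same-block : a / size l ≡ b / size l
        same-block = trans Dₐ./size (trans (cong₂ (λ u v → u * (M l + 2) + v) hi-eq mids≡) (sym D_b./size))
      ... | yes a-end =
        <⇒≱ a<b (subst₂ _≤_ (sym b≡) (sym a≡) (+-monoʳ-≤ (block * size (suc l) + D_b.mid * size l) D_b.lo≤p))
        where
        b≡ : b ≡ block * size (suc l) + D_b.mid * size l + D_b.lo
        b≡ = D_b.digits
        a≡ : a ≡ block * size (suc l) + D_b.mid * size l + p l
        a≡ = trans a-digits (cong₂ (λ u v → block * size (suc l) + u * size l + v) mids≡ a-end)

      ascent-from-inside : ¬ IsEnd l b → Ascent (e + h + e) (τ a) (τ b)
      ascent-from-inside b-not-end = (to-subEnd midₐ≤i sub≤K ++ᴬ along-ends l block Dₐ.mid i l<L midₐ≤i i≤M sub≤K)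
                                     ++ᴬ castᴬ prev≡ refl (from-prevEnd l b l<L b-not-end b≤K)
        where
        mid< : Dₐ.mid < D_b.mid
        mid< = ≤∧≢⇒< mid-mono (mids-differ b-not-end)
        i : ℕ
        i = pred D_b.mid
        mid≡1+i : D_b.mid ≡ suc i
        mid≡1+i = sym (suc-pred D_b.mid {{>-nonZero (≤-<-trans z≤n mid<)}})
        midₐ≤i : Dₐ.mid ≤ i
        midₐ≤i = ≤-pred (subst (Dₐ.mid <_) mid≡1+i mid<)
        i≤M : i ≤ M l
        i≤M = ≤-pred (≤-pred (subst₂ _<_ mid≡1+i (+-comm (M l) 2) D_b.mid<M+2))
        prev≡ : prevEnd l b ≡ subEnd block l i
        prev≡ = D_b.prevEnd≡subEnd mid≡1+i
        sub≤K : subEnd block l i ≤ K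
        sub≤K = subst (_≤ K) prev≡ (≤-trans (prevEnd≤ l b) b≤K)

      ascent : Ascent (e + h + e) (τ a) (τ b)
      ascent with b % size l ≟ p l
      ... | yes b-end     = ascent-from-end b-end
      ... | no b-not-end  = ascent-from-inside b-not-end

    ascent-< : ∀ {a b} → a < b → b ≤ K → Ascent (e + h + e) (τ a) (τ b)
    ascent-< {a} {b} a<b b≤K
      with turns-on (sameInterior? a b) (¬sameInterior₀ a<b) (sameInterior-below (<⇒≤ a<b) (≤-<-trans b≤K K<p))
    ... | l , l<L , ¬same , same = AtLevel.ascent a<b b≤K l<L ¬same same

    ascent : ∀ a b → a ≤ b → b ≤ K → Ascent (e + h + e) (τ a) (τ b)
    ascent a b a≤b b≤K with a ≟ b
    ... | yes refl = stay
    ... | no a≢b   = ascent-< (≤∧≢⇒< a≤b a≢b) b≤K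

Linked : (ℕ → List ℕ) → ℕ → ℕ → Set
Linked out x y = y ∈ out x ⊎ x ∈ out y

sumFin≡∑ : ∀ n (f : Fin n → ℕ) → sumFin n f ≡ ∑[ i < n ] f i
sumFin≡∑ zero    f = refl
sumFin≡∑ (suc n) f = cong (f fzero +_) (sumFin≡∑ n (f ∘ fsuc))

∑-mono-≤ : ∀ n {f g : Fin n → ℕ} → (∀ i → f i ≤ g i) → ∑[ i < n ] f i ≤ ∑[ i < n ] g i
∑-mono-≤ zero    f≤g = z≤n
∑-mono-≤ (suc n) f≤g = +-mono-≤ (f≤g fzero) (∑-mono-≤ n (f≤g ∘ fsuc))

sumFin-mono-≤ : ∀ n {f g : Fin n → ℕ} → (∀ i → f i ≤ g i) → sumFin n f ≤ sumFin n g
sumFin-mono-≤ n {f} {g} f≤g = subst₂ _≤_ (sym (sumFin≡∑ n f)) (sym (sumFin≡∑ n g)) (∑-mono-≤ n f≤g)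

∣S∣≡∑ : ∀ {n} (S : Subset n) → ∣ S ∣ ≡ ∑[ i < n ] bool→ℕ (lookup S i)
∣S∣≡∑ []          = refl
∣S∣≡∑ (true ∷ S)  = cong suc (∣S∣≡∑ S)
∣S∣≡∑ (false ∷ S) = ∣S∣≡∑ S

count-≡ᵇ : ∀ n y → ∑[ j < n ] bool→ℕ (toℕ j ≡ᵇ y) ≤ 1
count-≡ᵇ zero    y       = z≤n
count-≡ᵇ (suc n) zero    = s≤s (≤-reflexive (sum-replicate-zero n))
count-≡ᵇ (suc n) (suc y) = count-≡ᵇ n y

count-∈ : ∀ n xs → ∑[ j < n ] bool→ℕ (does (toℕ j ∈? xs)) ≤ length xs
count-∈ n []       = ≤-reflexive (sum-replicate-zero n)
-- does (x ∈? y ∷ xs) computes to (x ≡ᵇ y) ∨ does (x ∈? xs).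
count-∈ n (y ∷ xs) = begin
  ∑[ j < n ] bool→ℕ ((toℕ j ≡ᵇ y) ∨ does (toℕ j ∈? xs))
    ≤⟨ ∑-mono-≤ n (λ j → bool→ℕ-∨ (toℕ j ≡ᵇ y) _) ⟩
  ∑[ j < n ] (bool→ℕ (toℕ j ≡ᵇ y) + bool→ℕ (does (toℕ j ∈? xs)))
    ≡⟨ ∑-distrib-+ {n} (λ j → bool→ℕ (toℕ j ≡ᵇ y)) (λ j → bool→ℕ (does (toℕ j ∈? xs))) ⟩
  ∑[ j < n ] bool→ℕ (toℕ j ≡ᵇ y) + ∑[ j < n ] bool→ℕ (does (toℕ j ∈? xs))
    ≤⟨ +-mono-≤ (count-≡ᵇ n y) (count-∈ n xs) ⟩
  suc (length xs) ∎
  where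
  open ≤-Reasoning
  bool→ℕ-∨ : ∀ a b → bool→ℕ (a ∨ b) ≤ bool→ℕ a + bool→ℕ b
  bool→ℕ-∨ true  b = s≤s z≤n
  bool→ℕ-∨ false b = ≤-refl

mutual
  edgeCount-≤-sum : ∀ {n} (F : Graph n) → edgeCount F ≤ sumFin n (λ i → sumFin n (λ j → bool→ℕ (F i j)))
  edgeCount-≤-sum {n} F = sumFin-mono-≤ n (λ i → sumFin-mono-≤ n (λ j → ordered-pair≤ F i j))

  -- the summand of edgeCount, which is bool→ℕ (F i j) or 0
  ordered-pair≤ : ∀ {n} (F : Graph n) (i j : Fin n) → _ ≤ bool→ℕ (F i j)
  ordered-pair≤ F i j with toℕ i <? toℕ j
  ... | yes _ = ≤-refl
  ... | no _  = z≤n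

ceilDiv-≤ : ∀ {e c} t → e ≤ c * suc t → ceilDiv e (suc t) ≤ c
ceilDiv-≤ {e} {c} t e≤ = ≤-pred (m<n*o⇒m/o<n (begin-strict
  e + t                <⟨ +-monoʳ-< e (n<1+n t) ⟩
  e + suc t            ≤⟨ +-monoˡ-≤ (suc t) e≤ ⟩
  c * suc t + suc t    ≡⟨ +-comm (c * suc t) (suc t) ⟩
  suc c * suc t        ∎))
  where open ≤-Reasoning

module OutListGraph (n : ℕ) (out : ℕ → List ℕ) where

  linked? : ∀ x y → Dec (x ≢ y × Linked out x y)
  linked? x y = ¬? (x ≟ y) ×-dec (y ∈? out x ⊎-dec x ∈? out y)

  graph : Graph n
  graph u v = does (linked? (toℕ u) (toℕ v))

  graph-symmetric : SymmetricG graph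
  graph-symmetric u v = does-⇔ (mk⇔ flip flip) (linked? (toℕ u) (toℕ v)) (linked? (toℕ v) (toℕ u))
    where
    flip : ∀ {x y} → x ≢ y × Linked out x y → y ≢ x × Linked out y x
    flip (x≢y , linked) = x≢y ∘ sym , swap linked

  graph-irreflexive : IrreflexiveG graph
  graph-irreflexive u = dec-false (linked? (toℕ u) (toℕ u)) (λ (x≢x , _) → x≢x refl)

  graph-sound : ∀ u v → graph u v ≡ true → Linked out (toℕ u) (toℕ v)
  graph-sound u v uv = proj₂ (toWitness (Equivalence.from T-≡ (trans (isYes≗does (linked? (toℕ u) (toℕ v))) uv)))

  graph-complete : ∀ u v → toℕ u ≢ toℕ v → Linked out (toℕ u) (toℕ v) → graph u v ≡ true
  graph-complete u v u≢v linked = dec-true (linked? (toℕ u) (toℕ v)) (u≢v , linked)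

  -- Orienting each edge towards the list that contains it, every vertex has out-degree ≤ d.
  module _ {d : ℕ} (out≤d : ∀ x → length (out x) ≤ d) where

    owns : Subset n → Fin n → Fin n → ℕ
    owns S i j = bool→ℕ (lookup S i) * bool→ℕ (does (toℕ j ∈? out (toℕ i)))

    owned-≤ : ∀ S → ∑[ i < n ] ∑[ j < n ] owns S i j ≤ ∣ S ∣ * d
    owned-≤ S = begin
      ∑[ i < n ] ∑[ j < n ] owns S i j
        ≡⟨ sum-cong-≗ {n} (λ i → *-distribˡ-sum {n} (bool→ℕ (lookup S i)) (λ j → owned i j)) ⟨
      ∑[ i < n ] (bool→ℕ (lookup S i) * ∑[ j < n ] bool→ℕ (does (toℕ j ∈? out (toℕ i))))
        ≤⟨ ∑-mono-≤ n (λ i → *-monoʳ-≤ (bool→ℕ (lookup S i)) (≤-trans (count-∈ n (out (toℕ i))) (out≤d (toℕ i)))) ⟩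
      ∑[ i < n ] (bool→ℕ (lookup S i) * d)
        ≡⟨ *-distribʳ-sum {n} d (λ i → bool→ℕ (lookup S i)) ⟨
      ∑[ i < n ] bool→ℕ (lookup S i) * d
        ≡⟨ cong (_* d) (∣S∣≡∑ S) ⟨
      ∣ S ∣ * d ∎
      where
      open ≤-Reasoning
      owned : Fin n → Fin n → ℕ
      owned i j = bool→ℕ (does (toℕ j ∈? out (toℕ i)))

    owns≡1 : ∀ {S u v} → u ∈ˢ S → toℕ v ∈ out (toℕ u) → owns S u v ≡ 1
    owns≡1 u∈S v∈out = cong₂ _*_ (cong bool→ℕ ([]=⇒lookup u∈S)) (cong bool→ℕ (dec-true (_ ∈? _) v∈out))

    edge≤owns : ∀ S F → IsSubgraph graph S F → ∀ i j → bool→ℕ (F i j) ≤ owns S i j + owns S j i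
    edge≤owns S F (_ , F⊆) i j with F i j in Fij
    ... | false = z≤n
    ... | true with F⊆ i j Fij
    ...   | graph-ij , i∈S , j∈S with graph-sound i j graph-ij
    ...     | inj₁ j∈out = ≤-trans (≤-reflexive (sym (owns≡1 i∈S j∈out))) (m≤m+n (owns S i j) _)
    ...     | inj₂ i∈out = ≤-trans (≤-reflexive (sym (owns≡1 j∈S i∈out))) (m≤n+m (owns S j i) _)

    edgeCount-≤ : ∀ S F → IsSubgraph graph S F → edgeCount F ≤ 2 * (∣ S ∣ * d)
    edgeCount-≤ S F F⊆ = begin
      edgeCount F
        ≤⟨ edgeCount-≤-sum F ⟩
      sumFin n (λ i → sumFin n (λ j → bool→ℕ (F i j)))
        ≡⟨ trans (sumFin≡∑ n _) (sum-cong-≗ {n} (λ i → sumFin≡∑ n _)) ⟩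
      ∑[ i < n ] ∑[ j < n ] bool→ℕ (F i j)
        ≤⟨ ∑-mono-≤ n (λ i → ∑-mono-≤ n (λ j → edge≤owns S F F⊆ i j)) ⟩
      ∑[ i < n ] ∑[ j < n ] (owns S i j + owns S j i)
        ≡⟨ sum-cong-≗ {n} (λ i → ∑-distrib-+ {n} (owns S i) (λ j → owns S j i)) ⟩
      ∑[ i < n ] (∑[ j < n ] owns S i j + ∑[ j < n ] owns S j i)
        ≡⟨ ∑-distrib-+ {n} (λ i → ∑[ j < n ] owns S i j) (λ i → ∑[ j < n ] owns S j i) ⟩
      ∑[ i < n ] ∑[ j < n ] owns S i j + ∑[ i < n ] ∑[ j < n ] owns S j i
        ≡⟨ cong (∑[ i < n ] ∑[ j < n ] owns S i j +_) (∑-comm (λ i j → owns S j i)) ⟩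
      ∑[ i < n ] ∑[ j < n ] owns S i j + ∑[ j < n ] ∑[ i < n ] owns S j i
        ≤⟨ +-mono-≤ (owned-≤ S) (owned-≤ S) ⟩
      ∣ S ∣ * d + ∣ S ∣ * d
        ≡⟨ cong (∣ S ∣ * d +_) (+-identityʳ (∣ S ∣ * d)) ⟨
      2 * (∣ S ∣ * d) ∎
      where
      open ≤-Reasoning

    arboricity-≤ : Arboricity≤ graph (4 * d)
    arboricity-≤ S F F⊆ 2≤∣S∣ with ∣ S ∣ | 2≤∣S∣ | edgeCount-≤ S F F⊆
    ... | suc zero    | s≤s () | _
    ... | suc (suc t) | _ | count≤ =
      ceilDiv-≤ t (≤-trans count≤ (≤-trans (m≤m+n _ (2 * t * d)) (≤-reflexive (ring t d))))
      where
      ring : ∀ t d → 2 * (suc (suc t) * d) + 2 * t * d ≡ 4 * d * suc t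
      ring = solve-∀

module _ {n} {E : Graph n} where

  infixr 5 _++ᵂ_
  _++ᵂ_ : ∀ {a b c} → Walk E a b → Walk E b c → Walk E a c
  here       ++ᵂ q = q
  step e p   ++ᵂ q = step e (p ++ᵂ q)

  hops-++ : ∀ {a b c} (p : Walk E a b) (q : Walk E b c) → hops (p ++ᵂ q) ≡ hops p + hops q
  hops-++ here       q = refl
  hops-++ (step e p) q = cong suc (hops-++ p q)

  walkLength-++ : ∀ {a b c} (p : Walk E a b) (q : Walk E b c) → walkLength (p ++ᵂ q) ≡ walkLength p + walkLength q
  walkLength-++ here                   q = refl
  walkLength-++ (step {u} {w} e p) q = trans (cong (dist u w +_) (walkLength-++ p q)) (sym (+-assoc (dist u w) _ _))

  reverse : SymmetricG E → ∀ {a b} (p : Walk E a b) →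
            Σ (Walk E b a) λ q → hops q ≡ hops p × walkLength q ≡ walkLength p
  reverse E-sym here = here , refl , refl
  reverse E-sym (step {u} {w} e p) with reverse E-sym p
  ... | q , hops-q , length-q =
    q ++ᵂ step (trans (E-sym w u) e) here ,
    trans (hops-++ q _) (trans (+-comm (hops q) 1) (cong suc hops-q)) ,
    trans (walkLength-++ q _) (trans (cong₂ _+_ length-q (trans (+-identityʳ _) (∣-∣-comm (toℕ w) (toℕ u))))
                                      (+-comm (walkLength p) (dist u w)))

∸-telescope : ∀ {x y z} → x ≤ y → y ≤ z → (y ∸ x) + (z ∸ y) ≡ z ∸ x
∸-telescope {x} {y} {z} x≤y y≤z = sym (trans (cong (_∸ x) z≡) (m+n∸m≡n x _))
  where
  z≡ : z ≡ x + ((y ∸ x) + (z ∸ y))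
  z≡ = sym (trans (sym (+-assoc x (y ∸ x) (z ∸ y))) (trans (cong (_+ (z ∸ y)) (m+[n∸m]≡n x≤y)) (m+[n∸m]≡n y≤z)))

module AscentWalks (n : ℕ) (out : ℕ → List ℕ) where
  open OutListGraph n out
  open Ascents (Linked out)

  ascent⇒walk : ∀ {h x z} → Ascent h x z → ∀ (u v : Fin n) → toℕ u ≡ x → toℕ v ≡ z →
                Σ (Walk graph u v) λ w → hops w ≤ h × walkLength w ≡ z ∸ x
  ascent⇒walk {x = x} stay u v refl v≡ with toℕ-injective v≡
  ... | refl = here , z≤n , sym (n∸n≡0 x)
  ascent⇒walk {suc h} {x} {z} (step {y = y} x<y linked r) u v refl refl =
    step uw (proj₁ rest) , s≤s (proj₁ (proj₂ rest)) ,
    trans (cong₂ _+_ (trans (cong (∣ x -_∣) ŵ≡y) (m≤n⇒∣m-n∣≡n∸m (<⇒≤ x<y))) (proj₂ (proj₂ rest)))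
          (∸-telescope (<⇒≤ x<y) (ascent⇒≤ r))
    where
    y<n : y < n
    y<n = ≤-<-trans (ascent⇒≤ r) (toℕ<n v)
    w : Fin n
    w = fromℕ< y<n
    ŵ≡y : toℕ w ≡ y
    ŵ≡y = toℕ-fromℕ< y<n
    uw : graph u w ≡ true
    uw = graph-complete u w (λ x≡ŵ → <-irrefl (trans x≡ŵ ŵ≡y) x<y) (subst (Linked out x) (sym ŵ≡y) linked)
    rest : Σ (Walk graph w v) λ p → hops p ≤ h × walkLength p ≡ z ∸ y
    rest = ascent⇒walk r w v ŵ≡y refl

  walk-up : ∀ h → (∀ {a b} → a ≤ b → b < n → Ascent h a b) → ∀ u v → toℕ u ≤ toℕ v →
            Σ (Walk graph u v) λ p → hops p ≤ h × walkLength p ≡ dist u v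
  walk-up h ascent u v u≤v with ascent⇒walk (ascent u≤v (toℕ<n v)) u v refl refl
  ... | p , hops-p , length-p = p , hops-p , trans length-p (sym (m≤n⇒∣m-n∣≡n∸m u≤v))

  hopDiameter : ∀ h → (∀ {a b} → a ≤ b → b < n → Ascent h a b) → HopDiameter≤ graph h
  hopDiameter h ascent u v with toℕ u ≤? toℕ v
  ... | yes u≤v = walk-up h ascent u v u≤v
  ... | no u≰v with walk-up h ascent v u (<⇒≤ (≰⇒> u≰v))
  ...   | p , hops-p , length-p with reverse graph-symmetric p
  ...     | q , hops-q , length-q =
    q , subst (_≤ h) (sym hops-q) hops-p , trans length-q (trans length-p (∣-∣-comm (toℕ v) (toℕ u)))

-- span j l + 1 is the length of a level-l block in the construction of hop-diameter 2 * (j + 1);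
-- with m helpers per gap, helperNbrs j achieves hop-diameter 2 * j on 0 … K whenever K ≤ capacity j m.
mutual
  span : ℕ → ℕ → ℕ
  span j zero    = 1
  span j (suc l) = (capacity j (2 * span j l) + 1) * suc (span j l) + span j l

  capacity : ℕ → ℕ → ℕ
  capacity zero          m = 0
  capacity (suc zero)    m = m
  capacity (suc (suc j)) m = pred (span j (m / 4))

span-size-suc : ∀ j l → suc (span j (suc l)) ≡ (capacity j (2 * span j l) + 2) * suc (span j l)
span-size-suc j l = ring (capacity j (2 * span j l)) (span j l)
  where
  ring : ∀ c p → suc ((c + 1) * suc p + p) ≡ (c + 2) * suc p
  ring = solve-∀

module SpanHierarchy (j : ℕ) = Hierarchy (span j) (λ l → capacity j (2 * span j l)) (span-size-suc j)

1≤span : ∀ j l → 1 ≤ span j l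
1≤span j zero    = ≤-refl
1≤span j (suc l) = ≤-trans (1≤span j l) (m≤n+m _ _)

-- The gaps of τ between consecutive level-l block ends of the B-th level-(suc l) block, with the
-- points of the block as helpers: the r-th helper of gap i is the (r / 2)-th interior point of
-- block suc i, used through its helper index 2 * L + (2 * l + r % 2).
module Subpath (p : ℕ → ℕ) (τ : ℕ → ℕ) (π : ℕ → ℕ → ℕ) (L B l : ℕ) where
  open Blocks p

  point : ℕ → ℕ → ℕ
  point i r = B * size (suc l) + suc i * size l + r / 2

  τₛ : ℕ → ℕ
  τₛ i = τ (subEnd B l i)

  πₛ : ℕ → ℕ → ℕ
  πₛ i r = π (point i r) (2 * L + (2 * l + r % 2))

-- helperNbrs j τ π m a r: the neighbours of the r-th of the m helpers π a r placed in the gap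
-- between τ a and τ (suc a).  With L = m / 4 helpers r < L jump to the end of the level-r block,
-- L more jump back from suc a, and the rest serve the subpaths of level-l block ends.
mutual
  helperNbrs : ℕ → (ℕ → ℕ) → (ℕ → ℕ → ℕ) → ℕ → ℕ → ℕ → List ℕ
  helperNbrs zero          τ π m a r = []
  helperNbrs (suc zero)    τ π m a r = τ a ∷ τ (a + suc r) ∷ []
  helperNbrs (suc (suc j)) τ π m a r with r <? m / 4
  ... | yes _ = τ a ∷ τ (Blocks.end (span j) r a) ∷ []
  ... | no _ with r ∸ m / 4 <? m / 4
  ...   | yes _ = τ (suc a) ∷ τ (Blocks.prevEnd (span j) (r ∸ m / 4) (suc a)) ∷ []
  ...   | no _  = deepNbrs j τ π (m / 4) a (r ∸ 2 * (m / 4))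

  -- With l = t / 2, a lies in block mid of its level-(suc l) block, hence in gap mid ∸ 1 of the
  -- subpath (junk when mid = 0).
  deepNbrs : ℕ → (ℕ → ℕ) → (ℕ → ℕ → ℕ) → ℕ → ℕ → ℕ → List ℕ
  deepNbrs j τ π L a t =
    subpathNbrs j τ π L (Digits.hi l a) l (Digits.mid l a ∸ 1) (2 * Digits.lo l a + t % 2)
    where
    open SpanHierarchy j
    l : ℕ
    l = t / 2

  subpathNbrs : ℕ → (ℕ → ℕ) → (ℕ → ℕ → ℕ) → ℕ → ℕ → ℕ → ℕ → ℕ → List ℕ
  subpathNbrs j τ π L B l =
    helperNbrs j (Subpath.τₛ (span j) τ π L B l) (Subpath.πₛ (span j) τ π L B l) (2 * span j l)

mutual
  helperNbrs-length : ∀ j τ π m a r → length (helperNbrs j τ π m a r) ≤ 2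
  helperNbrs-length zero          τ π m a r = z≤n
  helperNbrs-length (suc zero)    τ π m a r = ≤-refl
  helperNbrs-length (suc (suc j)) τ π m a r with r <? m / 4
  ... | yes _ = ≤-refl
  ... | no _ with r ∸ m / 4 <? m / 4
  ...   | yes _ = ≤-refl
  ...   | no _  = deepNbrs-length j τ π (m / 4) a (r ∸ 2 * (m / 4))

  deepNbrs-length : ∀ j τ π L a t → length (deepNbrs j τ π L a t) ≤ 2
  deepNbrs-length j τ π L a t =
    subpathNbrs-length j τ π L (Digits.hi l a) l (Digits.mid l a ∸ 1) (2 * Digits.lo l a + t % 2)
    where
    open SpanHierarchy j
    l : ℕ
    l = t / 2

  subpathNbrs-length : ∀ j τ π L B l i r → length (subpathNbrs j τ π L B l i r) ≤ 2
  subpathNbrs-length j τ π L B l =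
    helperNbrs-length j (Subpath.τₛ (span j) τ π L B l) (Subpath.πₛ (span j) τ π L B l) (2 * span j l)

module _ (j : ℕ) (τ : ℕ → ℕ) (π : ℕ → ℕ → ℕ) (m a : ℕ) where
  open Blocks (span j)

  helperNbrs-end : ∀ {l} → l < m / 4 → helperNbrs (suc (suc j)) τ π m a l ≡ τ a ∷ τ (end l a) ∷ []
  helperNbrs-end {l} l<L with l <? m / 4
  ... | yes _   = refl
  ... | no l≮L  = ⊥-elim (l≮L l<L)

  helperNbrs-prevEnd : ∀ {l} → l < m / 4 →
    helperNbrs (suc (suc j)) τ π m a (m / 4 + l) ≡ τ (suc a) ∷ τ (prevEnd l (suc a)) ∷ []
  helperNbrs-prevEnd {l} l<L with m / 4 + l <? m / 4
  ... | yes L+l<L = ⊥-elim (<⇒≱ L+l<L (m≤m+n (m / 4) l))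
  ... | no _ with m / 4 + l ∸ m / 4 <? m / 4
  ...   | yes _  = cong (λ t → τ (suc a) ∷ τ (prevEnd t (suc a)) ∷ []) (m+n∸m≡n (m / 4) l)
  ...   | no ¬<L = ⊥-elim (¬<L (subst (_< m / 4) (sym (m+n∸m≡n (m / 4) l)) l<L))

  helperNbrs-deep : ∀ t → helperNbrs (suc (suc j)) τ π m a (2 * (m / 4) + t) ≡ deepNbrs j τ π (m / 4) a t
  helperNbrs-deep t with 2 * (m / 4) + t <? m / 4
  ... | yes <L = ⊥-elim (<⇒≱ <L (≤-trans (m≤m+n (m / 4) (m / 4 + 0)) (m≤m+n _ t)))
  ... | no _ with 2 * (m / 4) + t ∸ m / 4 <? m / 4
  ...   | yes <L = ⊥-elim (<⇒≱ <L (subst (m / 4 ≤_) (sym drop-L) (m≤m+n (m / 4) _)))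
    where
    drop-L : 2 * (m / 4) + t ∸ m / 4 ≡ m / 4 + t
    drop-L = trans (cong (_∸ m / 4) (+-assoc (m / 4) (m / 4 + 0) t)) (trans (m+n∸m≡n (m / 4) _)
               (cong (_+ t) (+-identityʳ (m / 4))))
  ...   | no _   = cong (deepNbrs j τ π (m / 4) a) (m+n∸m≡n (2 * (m / 4)) t)

module SubpathPoint (j : ℕ) (τ : ℕ → ℕ) (π : ℕ → ℕ → ℕ) (L B l i r : ℕ)
                    (i<M : i < capacity j (2 * span j l)) (r<2p : r < 2 * span j l) where
  open Blocks (span j)
  open SpanHierarchy j
  open Subpath (span j) τ π L B l

  z : ℕ
  z = point i r

  r/2<p : r / 2 < span j l
  r/2<p = m<n*o⇒m/o<n (subst (r <_) (*-comm 2 (span j l)) r<2p)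

  subEnd<z : subEnd B l i < z
  subEnd<z = subst (subEnd B l i <_) (sym (subEnd-+ B l i (r / 2))) (m<m+n _ z<s)

  z<subEnd : z < subEnd B l (suc i)
  z<subEnd = +-monoʳ-< (B * size (suc l) + suc i * size l) r/2<p

  deepNbrs-z : deepNbrs j τ π L z (2 * l + r % 2) ≡ subpathNbrs j τ π L B l i r
  deepNbrs-z = begin
    deepNbrs j τ π L z (2 * l + r % 2)
      ≡⟨ cong₂ (λ l′ c → subpathNbrs j τ π L (Digits.hi l′ z) l′ (Digits.mid l′ z ∸ 1)
                                       (2 * Digits.lo l′ z + c))
               (proj₁ halves) (proj₂ halves) ⟩
    subpathNbrs j τ π L (Digits.hi l z) l (Digits.mid l z ∸ 1) (2 * Digits.lo l z + r % 2)
      ≡⟨ cong₃ (λ B′ i′ q → subpathNbrs j τ π L B′ l (i′ ∸ 1) (2 * q + r % 2))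
                 (proj₁ digits) (proj₁ (proj₂ digits)) (proj₂ (proj₂ digits)) ⟩
    subpathNbrs j τ π L B l i (2 * (r / 2) + r % 2)
      ≡⟨ cong (subpathNbrs j τ π L B l i) (sym r≡) ⟩
    subpathNbrs j τ π L B l i r ∎
    where
    open ≡-Reasoning
    cong₃ : ∀ {A B C D : Set} (f : A → B → C → D) {x x′ y y′ u u′} →
            x ≡ x′ → y ≡ y′ → u ≡ u′ → f x y u ≡ f x′ y′ u′
    cong₃ f refl refl refl = refl
    halves : (2 * l + r % 2) / 2 ≡ l × (2 * l + r % 2) % 2 ≡ r % 2
    halves = halve-2l+c l (m%n<n r 2)
    1+i<M+2 : suc i < capacity j (2 * span j l) + 2
    1+i<M+2 = ≤-trans (s≤s i<M) (≤-trans (n≤1+n _) (≤-reflexive (+-comm 2 _)))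
    digits : Digits.hi l z ≡ B × Digits.mid l z ≡ suc i × Digits.lo l z ≡ r / 2
    digits = digits-of {l} B {suc i} {r / 2} 1+i<M+2 (m<n⇒m<1+n r/2<p)
    r≡ : r ≡ 2 * (r / 2) + r % 2
    r≡ = trans (m≡m%n+[m/n]*n r 2) (trans (+-comm (r % 2) _) (cong (_+ r % 2) (*-comm (r / 2) 2)))

module HelperIndices {L m : ℕ} (4L≤m : L * 4 ≤ m) where

  <4L⇒<m : ∀ {r} → r < 2 * L + 2 * L → r < m
  <4L⇒<m r< = <-≤-trans r< (subst (_≤ m) (sym (quadruple L)) 4L≤m)
    where
    quadruple : ∀ L → 2 * L + 2 * L ≡ L * 4
    quadruple = solve-∀

  end-index : ∀ {l} → l < L → l < m
  end-index l<L = <4L⇒<m (<-≤-trans l<L (≤-trans (m≤m+n L (L + 0)) (m≤m+n (2 * L) (2 * L))))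

  prevEnd-index : ∀ {l} → l < L → L + l < m
  prevEnd-index {l} l<L = <4L⇒<m (begin-strict
    L + l          <⟨ +-monoʳ-< L l<L ⟩
    L + L          ≡⟨ cong (L +_) (+-identityʳ L) ⟨
    2 * L          ≤⟨ m≤m+n (2 * L) (2 * L) ⟩
    2 * L + 2 * L  ∎)
    where open ≤-Reasoning

  deep-index : ∀ {l c} → l < L → c < 2 → 2 * L + (2 * l + c) < m
  deep-index {l} {c} l<L c<2 = <4L⇒<m (begin-strict
    2 * L + (2 * l + c)  <⟨ +-monoʳ-< (2 * L) (+-monoʳ-< (2 * l) c<2) ⟩
    2 * L + (2 * l + 2)  ≡⟨ cong (2 * L +_) (trans (*-suc 2 l) (+-comm 2 (2 * l))) ⟨
    2 * L + 2 * suc l    ≤⟨ +-monoʳ-≤ (2 * L) (*-monoʳ-≤ 2 l<L) ⟩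
    2 * L + 2 * L        ∎)
    where open ≤-Reasoning

module Wiring (Adj : ℕ → ℕ → Set) (sym-Adj : ∀ {x y} → Adj x y → Adj y x) where

  open Ascents Adj

  record Helpers (j : ℕ) (τ : ℕ → ℕ) (π : ℕ → ℕ → ℕ) (m K : ℕ) : Set where
    field
      τ-mono : ∀ {x y} → x < y → y ≤ K → τ x < τ y
      in-gap : ∀ {a r} → a < K → r < m → τ a < π a r × π a r < τ (suc a)
      wired  : ∀ {a r y} → a < K → r < m → y ∈ helperNbrs j τ π m a r → Adj (π a r) y

    τ-mono-≤ : ∀ {x y} → x ≤ y → y ≤ K → τ x ≤ τ y
    τ-mono-≤ x≤y y≤K with m≤n⇒m<n∨m≡n x≤y
    ... | inj₁ x<y  = <⇒≤ (τ-mono x<y y≤K)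
    ... | inj₂ refl = ≤-refl

    via-helper : ∀ {a r u v} → a < K → r < m →
                 u ∈ helperNbrs j τ π m a r → v ∈ helperNbrs j τ π m a r →
                 u < π a r → π a r < v → Ascent 2 u v
    via-helper a<K r<m u∈ v∈ u<π π<v = step u<π (sym-Adj (wired a<K r<m u∈)) (edge π<v (wired a<K r<m v∈))

  module Deep {j τ π m K} (H : Helpers (suc (suc j)) τ π m K) where
    open Helpers H
    open Blocks (span j)
    open HelperIndices {m / 4} {m} (m/n*n≤m m 4)

    L : ℕ
    L = m / 4

    to-end-ascent : ∀ {l a} → l < L → ¬ IsEnd l a → end l a ≤ K → Ascent 2 (τ a) (τ (end l a))
    to-end-ascent {l} {a} l<L not-end end≤K =
      via-helper a<K r<m (∈nbrs (here refl)) (∈nbrs (there (here refl))) (proj₁ gap)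
                 (<-≤-trans (proj₂ gap) (τ-mono-≤ (<-end l a not-end) end≤K))
      where
      a<K : a < K
      a<K = <-≤-trans (<-end l a not-end) end≤K
      r<m : l < m
      r<m = end-index l<L
      gap : τ a < π a l × π a l < τ (suc a)
      gap = in-gap a<K r<m
      ∈nbrs : ∀ {y} → y ∈ τ a ∷ τ (end l a) ∷ [] → y ∈ helperNbrs (suc (suc j)) τ π m a l
      ∈nbrs = subst (_ ∈_) (sym (helperNbrs-end j τ π m a l<L))

    from-prevEnd-ascent : ∀ {l b} → l < L → b ≤ K → Ascent 2 (τ (prevEnd l b)) (τ b)
    from-prevEnd-ascent {l} {zero}  l<L b≤K = stay
    from-prevEnd-ascent {l} {suc a} l<L b≤K =
      via-helper a<K r<m (∈nbrs (there (here refl))) (∈nbrs (here refl))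
                 (≤-<-trans (τ-mono-≤ (m∸n≤m a (suc a % size l)) (<⇒≤ a<K)) (proj₁ gap)) (proj₂ gap)
      where
      a<K : a < K
      a<K = <-≤-trans ≤-refl b≤K
      r<m : L + l < m
      r<m = prevEnd-index l<L
      gap : τ a < π a (L + l) × π a (L + l) < τ (suc a)
      gap = in-gap a<K r<m
      ∈nbrs : ∀ {y} → y ∈ τ (suc a) ∷ τ (prevEnd l (suc a)) ∷ [] → y ∈ helperNbrs (suc (suc j)) τ π m a (L + l)
      ∈nbrs = subst (_ ∈_) (sym (helperNbrs-prevEnd j τ π m a l<L))

    subpath-helpers : ∀ {l B i′} → l < L → i′ ≤ capacity j (2 * span j l) → subEnd B l i′ ≤ K →
      Helpers j (Subpath.τₛ (span j) τ π L B l) (Subpath.πₛ (span j) τ π L B l) (2 * span j l) i′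
    subpath-helpers {l} {B} {i′} l<L i′≤M top≤K = record
      { τ-mono = λ {x} {y} x<y y≤i′ → τ-mono (subEnd-mono-< B l x<y) (≤-trans (subEnd-mono-≤ B l y≤i′) top≤K)
      ; in-gap = λ {i} i<i′ r< → let open Point i<i′ r< in
          <-trans (τ-mono subEnd<z (<⇒≤ z<K)) (proj₁ (gap-z)) ,
          <-≤-trans (proj₂ gap-z) (τ-mono-≤ z<subEnd (≤-trans (subEnd-mono-≤ B l i<i′) top≤K))
      ; wired  = λ {i} i<i′ r< y∈ → let open Point i<i′ r< in
          wired z<K s<m (subst (_ ∈_) (sym (trans (helperNbrs-deep j τ π m z _) deepNbrs-z)) y∈)
      }
      where
      module Point {i r} (i<i′ : i < i′) (r< : r < 2 * span j l) where
        open SubpathPoint j τ π L B l i r (<-≤-trans i<i′ i′≤M) r< public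
        z<K : z < K
        z<K = <-≤-trans z<subEnd (≤-trans (subEnd-mono-≤ B l i<i′) top≤K)
        s<m : 2 * L + (2 * l + r % 2) < m
        s<m = deep-index l<L (m%n<n r 2)
        gap-z : τ z < π z (2 * L + (2 * l + r % 2)) × π z (2 * L + (2 * l + r % 2)) < τ (suc z)
        gap-z = in-gap z<K s<m

  helpers-ascent : ∀ j {τ π m K} → Helpers j τ π m K → K ≤ capacity j m →
                   ∀ {a b} → a ≤ b → b ≤ K → Ascent (2 * j) (τ a) (τ b)
  helpers-ascent zero H z≤n z≤n z≤n = stay
  helpers-ascent (suc zero) {τ} {π} {m} {K} H K≤m {a} a≤b b≤K with m≤n⇒∃[o]m+o≡n a≤b
  ... | zero  , refl = subst (λ x → Ascent 2 (τ a) (τ x)) (sym (+-identityʳ a)) stay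
  ... | suc r , refl =
    via-helper a<K r<m (here refl) (there (here refl)) (proj₁ gap) (<-≤-trans (proj₂ gap) (τ-mono-≤ a<b b≤K))
    where
    open Helpers H
    a<b : a < a + suc r
    a<b = m<m+n a z<s
    a<K : a < K
    a<K = <-≤-trans a<b b≤K
    r<m : r < m
    r<m = ≤-trans (≤-trans (m≤n+m (suc r) a) b≤K) K≤m
    gap : τ a < π a r × π a r < τ (suc a)
    gap = in-gap a<K r<m
  helpers-ascent (suc (suc j)) {τ} {π} {m} {K} H K≤cap a≤b b≤K =
    weaken (≤-reflexive (hop-count j))
      (Route.ascent τ L K 2 (2 * j) K<span
        (λ _ _ l<L not-end end≤K → to-end-ascent l<L not-end end≤K)
        (λ _ _ l<L _ b≤K → from-prevEnd-ascent l<L b≤K)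
        (λ _ B _ _ l<L i≤i′ i′≤M top≤K →
           helpers-ascent j (subpath-helpers {B = B} l<L i′≤M top≤K) i′≤M i≤i′ ≤-refl)
        _ _ a≤b b≤K)
    where
    open Deep H
    open Routing Adj (span j) (λ l → capacity j (2 * span j l)) refl (span-size-suc j)
    K<span : K < span j L
    K<span = m≤pred[n]⇒suc[m]≤n {{>-nonZero (1≤span j L)}} K≤cap
    hop-count : ∀ j → 2 + 2 * j + 2 ≡ 2 * suc (suc j)
    hop-count = solve-∀

-- In the shortcut the helpers are the points of the path themselves (so the helper index is
-- irrelevant and the L argument of deepNbrs is arbitrary).
levelNbrs : ℕ → ℕ → ℕ → List ℕ
levelNbrs j l x = Blocks.prevEnd (span j) l x ∷ Blocks.end (span j) l x ∷ deep 0 ++ deep 1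
  where
  deep : ℕ → List ℕ
  deep c = deepNbrs j id const 0 x (2 * l + c)

outNbrs : ℕ → ℕ → ℕ → List ℕ
outNbrs j zero    x = []
outNbrs j (suc S) x = levelNbrs j S x ++ outNbrs j S x

outNbrs-length : ∀ j S x → length (outNbrs j S x) ≤ 6 * S
outNbrs-length j zero    x = z≤n
outNbrs-length j (suc S) x = begin
  length (levelNbrs j S x ++ outNbrs j S x)
    ≡⟨ length-++ (levelNbrs j S x) ⟩
  2 + length (deep 0 ++ deep 1) + length (outNbrs j S x)
    ≡⟨ cong (λ t → 2 + t + length (outNbrs j S x)) (length-++ (deep 0)) ⟩
  2 + (length (deep 0) + length (deep 1)) + length (outNbrs j S x)
    ≤⟨ +-mono-≤ (+-monoʳ-≤ 2 (+-mono-≤ (deep≤2 0) (deep≤2 1))) (outNbrs-length j S x) ⟩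
  6 + 6 * S
    ≡⟨ *-suc 6 S ⟨
  6 * suc S ∎
  where
  open ≤-Reasoning
  deep : ℕ → List ℕ
  deep c = deepNbrs j id const 0 x (2 * S + c)
  deep≤2 : ∀ c → length (deep c) ≤ 2
  deep≤2 c = deepNbrs-length j id const 0 x (2 * S + c)

∈-outNbrs : ∀ j {l S x y} → l < S → y ∈ levelNbrs j l x → y ∈ outNbrs j S x
∈-outNbrs j {l} {suc S} {x} l<1+S y∈ with m≤n⇒m<n∨m≡n (≤-pred l<1+S)
... | inj₁ l<S  = ∈-++⁺ʳ (levelNbrs j S x) (∈-outNbrs j l<S y∈)
... | inj₂ refl = ∈-++⁺ˡ y∈

module Shortcut (j S : ℕ) where

  open Blocks (span j)
  open Ascents (Linked (outNbrs j S))
  open Wiring (Linked (outNbrs j S)) swap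

  subpath-helpers : ∀ {l B i′} → l < S → i′ ≤ capacity j (2 * span j l) →
    Helpers j (Subpath.τₛ (span j) id const 0 B l) (Subpath.πₛ (span j) id const 0 B l) (2 * span j l) i′
  subpath-helpers {l} {B} {i′} l<S i′≤M = record
    { τ-mono = λ x<y _ → subEnd-mono-< B l x<y
    ; in-gap = λ i<i′ r< → let open Point i<i′ r< in subEnd<z , z<subEnd
    ; wired  = λ {i} {r} i<i′ r< y∈ → let open Point i<i′ r< in
        inj₁ (∈-outNbrs j l<S (∈-deep (m%n<n r 2) (subst (_ ∈_) (sym deepNbrs-z) y∈)))
    }
    where
    module Point {i r} (i<i′ : i < i′) (r< : r < 2 * span j l) where
      open SubpathPoint j id const 0 B l i r (<-≤-trans i<i′ i′≤M) r< public
      ∈-deep : ∀ {c y} → c < 2 → y ∈ deepNbrs j id const 0 z (2 * l + c) → y ∈ levelNbrs j l z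
      ∈-deep {0} _ y∈ = there (there (∈-++⁺ˡ y∈))
      ∈-deep {1} _ y∈ = there (there (∈-++⁺ʳ (deepNbrs j id const 0 z (2 * l + 0)) y∈))
      ∈-deep {suc (suc _)} (s≤s (s≤s ()))

  shortcut-ascent : ∀ {a b} → a ≤ b → b < span j S → Ascent (2 * suc j) a b
  shortcut-ascent {a} {b} a≤b b<span =
    weaken (≤-reflexive (hop-count j))
      (Route.ascent id S b 1 (2 * j) b<span to-end from-prevEnd along-ends a b a≤b ≤-refl)
    where
    open Routing (Linked (outNbrs j S)) (span j) (λ l → capacity j (2 * span j l)) refl (span-size-suc j)
    hop-count : ∀ j → 1 + 2 * j + 1 ≡ 2 * suc j
    hop-count = solve-∀
    to-end : ∀ l a → l < S → ¬ IsEnd l a → end l a ≤ b → Ascent 1 a (end l a)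
    to-end l a l<S not-end _ = edge (<-end l a not-end) (inj₁ (∈-outNbrs j l<S (there (here refl))))
    from-prevEnd : ∀ l c → l < S → ¬ IsEnd l c → c ≤ b → Ascent 1 (prevEnd l c) c
    from-prevEnd l zero    _   _ _ = stay
    from-prevEnd l (suc c) l<S _ _ = edge (s≤s (m∸n≤m c (suc c % size l))) (inj₂ (∈-outNbrs j l<S (here refl)))
    along-ends : ∀ l B i i′ → l < S → i ≤ i′ → i′ ≤ capacity j (2 * span j l) → subEnd B l i′ ≤ b →
                 Ascent (2 * j) (subEnd B l i) (subEnd B l i′)
    along-ends l B i i′ l<S i≤i′ i′≤M _ =
      helpers-ascent j (subpath-helpers {B = B} l<S i′≤M) i′≤M i≤i′ ≤-refl

span-mono : ∀ j {l l′} → l ≤ l′ → span j l ≤ span j l′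
span-mono j {l} l≤l′ with m≤n⇒∃[o]m+o≡n l≤l′
... | k , refl = grow k
  where
  grow : ∀ k → span j l ≤ span j (l + k)
  grow zero    = ≤-reflexive (cong (span j) (sym (+-identityʳ l)))
  grow (suc k) = ≤-trans (grow k) (≤-trans (m≤n+m _ _) (≤-reflexive (cong (span j) (sym (+-suc l k)))))

span-doubles : ∀ j l → 2 * span j l + 1 ≤ span j (suc l)
span-doubles j l = begin
  2 * x + 1                          ≡⟨ ring x ⟩
  1 * suc x + x                      ≤⟨ +-monoˡ-≤ x (*-monoˡ-≤ (suc x) (m≤n+m 1 (capacity j (2 * x)))) ⟩
  (capacity j (2 * x) + 1) * suc x + x ∎
  where
  open ≤-Reasoning
  x : ℕ
  x = span j l
  ring : ∀ x → 2 * x + 1 ≡ 1 * suc x + x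
  ring = solve-∀

capacity<span : ∀ j l → capacity j (2 * span j l) + 1 ≤ span j (suc l)
capacity<span j l = ≤-trans (m≤m*n (capacity j (2 * span j l) + 1) (suc (span j l))) (m≤m+n _ (span j l))

31≤span₄ : ∀ j → 31 ≤ span j 4
31≤span₄ j = ≥2*+1 3 15 (≥2*+1 2 7 (≥2*+1 1 3 (≥2*+1 0 1 ≤-refl)))
  where
  ≥2*+1 : ∀ l c → c ≤ span j l → 2 * c + 1 ≤ span j (suc l)
  ≥2*+1 l c c≤ = ≤-trans (+-monoˡ-≤ 1 (*-monoʳ-≤ 2 c≤)) (span-doubles j l)

square≤span₁ : ∀ l → span 1 l * span 1 l ≤ span 1 (suc l)
square≤span₁ l = begin
  x * x                  ≤⟨ *-monoʳ-≤ x (n≤1+n x) ⟩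
  x * suc x              ≤⟨ *-monoˡ-≤ (suc x) (m≤n+m x (x + 1)) ⟩
  (x + 1 + x) * suc x    ≡⟨ cong (_* suc x) (ring x) ⟩
  (2 * x + 1) * suc x    ≤⟨ m≤m+n _ x ⟩
  (2 * x + 1) * suc x + x ∎
  where
  open ≤-Reasoning
  x : ℕ
  x = span 1 l
  ring : ∀ x → x + 1 + x ≡ 2 * x + 1
  ring = solve-∀

-- The constants make both the base cases (via 31 ≤ span j 4) and the iteration step go through.
Outgrows : ℕ → (ℕ → ℕ) → Set
Outgrows j G = ∀ s → 4 * G s + 8 ≤ span j (s + 4)

outgrows-A₁ : Outgrows 0 (A 1)
outgrows-A₁ zero    = ≤-trans (m≤m+n 12 19) (31≤span₄ 0)
outgrows-A₁ (suc s) = begin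
  4 * (2 * A 1 s) + 8      ≤⟨ m≤m+n _ 9 ⟩
  4 * (2 * A 1 s) + 8 + 9  ≡⟨ ring (A 1 s) ⟨
  2 * (4 * A 1 s + 8) + 1  ≤⟨ +-monoˡ-≤ 1 (*-monoʳ-≤ 2 (outgrows-A₁ s)) ⟩
  2 * span 0 (s + 4) + 1   ≤⟨ span-doubles 0 (s + 4) ⟩
  span 0 (suc (s + 4))     ∎
  where
  open ≤-Reasoning
  ring : ∀ a → 2 * (4 * a + 8) + 1 ≡ 4 * (2 * a) + 8 + 9
  ring = solve-∀

outgrows-B₁ : Outgrows 1 (B 1)
outgrows-B₁ zero    = ≤-trans (m≤m+n 16 15) (31≤span₄ 1)
outgrows-B₁ (suc s) = begin
  4 * (y * y) + 8                                      ≤⟨ m≤m+n _ _ ⟩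
  4 * (y * y) + 8 + (12 * (y * y) + 64 * y + 56)       ≡⟨ ring y ⟨
  (4 * y + 8) * (4 * y + 8)                            ≤⟨ *-mono-≤ (outgrows-B₁ s) (outgrows-B₁ s) ⟩
  span 1 (s + 4) * span 1 (s + 4)                      ≤⟨ square≤span₁ (s + 4) ⟩
  span 1 (suc (s + 4))                                 ∎
  where
  open ≤-Reasoning
  y : ℕ
  y = B 1 s
  ring : ∀ y → (4 * y + 8) * (4 * y + 8) ≡ 4 * (y * y) + 8 + (12 * (y * y) + 64 * y + 56)
  ring = solve-∀

outgrows-iterate : ∀ j (G G′ : ℕ → ℕ) → Outgrows j G → G′ 0 ≤ 2 → (∀ s → G′ (suc s) ≡ G (G′ s)) →
                   Outgrows (suc (suc j)) G′
outgrows-iterate j G G′ G≺ G′₀≤2 G′-suc zero    =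
  ≤-trans (+-monoˡ-≤ 8 (*-monoʳ-≤ 4 G′₀≤2)) (≤-trans (m≤m+n 16 15) (31≤span₄ (suc (suc j))))
outgrows-iterate j G G′ G≺ G′₀≤2 G′-suc (suc s) = begin
  4 * G′ (suc s) + 8                           ≡⟨ cong (λ t → 4 * t + 8) (G′-suc s) ⟩
  4 * G y + 8                                  ≤⟨ G≺ y ⟩
  span j (y + 4)                               ≤⟨ span-mono j y+4≤ ⟩
  span j (2 * X / 4)                           ≡⟨ suc-pred (span j (2 * X / 4)) {{>-nonZero (1≤span j (2 * X / 4))}} ⟨
  suc (capacity (suc (suc j)) (2 * X))         ≡⟨ +-comm 1 _ ⟩
  capacity (suc (suc j)) (2 * X) + 1           ≤⟨ capacity<span (suc (suc j)) (s + 4) ⟩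
  span (suc (suc j)) (suc (s + 4))             ∎
  where
  open ≤-Reasoning
  y X : ℕ
  y = G′ s
  X = span (suc (suc j)) (s + 4)
  ring₁ : ∀ y → (y + 4) * 4 + 4 * y ≡ 2 * (4 * y + 8)
  ring₁ = solve-∀
  y+4≤ : y + 4 ≤ 2 * X / 4
  y+4≤ = begin
    y + 4                 ≡⟨ m*n/n≡m (y + 4) 4 ⟨
    (y + 4) * 4 / 4       ≤⟨ /-monoˡ-≤ 4 (≤-trans (m≤m+n ((y + 4) * 4) (4 * y)) (≤-trans (≤-reflexive (ring₁ y))
                                (*-monoʳ-≤ 2 (outgrows-iterate j G G′ G≺ G′₀≤2 G′-suc s)))) ⟩
    2 * X / 4             ∎

outgrows-A : ∀ i → Outgrows (i + i) (A (suc i))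
outgrows-A zero    = outgrows-A₁
outgrows-A (suc i) = subst (λ j → Outgrows j (A (suc (suc i)))) (cong suc (sym (+-suc i i)))
  (outgrows-iterate (i + i) (A (suc i)) (A (suc (suc i))) (outgrows-A i) (s≤s z≤n) (λ _ → refl))

outgrows-B : ∀ i → Outgrows (suc (i + i)) (B (suc i))
outgrows-B zero    = outgrows-B₁
outgrows-B (suc i) = subst (λ j → Outgrows (suc j) (B (suc (suc i)))) (cong suc (sym (+-suc i i)))
  (outgrows-iterate (suc (i + i)) (B (suc i)) (B (suc (suc i))) (outgrows-B i) ≤-refl (λ _ → refl))

outgrows⇒≤ : ∀ {j G} → Outgrows j G → ∀ s → G s ≤ span j (s + 4)
outgrows⇒≤ G≺ s = ≤-trans (≤-trans (m≤n*m _ 4) (m≤m+n _ 8)) (G≺ s)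

Grow-A : ∀ m s → m % 2 ≡ 0 → Grow m s ≡ A ⌊ m /2⌋ s
Grow-A m s m-even with m % 2 | m-even
... | zero | _ = refl

Grow-B : ∀ m s → m % 2 ≡ 1 → Grow m s ≡ B ⌊ m /2⌋ s
Grow-B m s m-odd with m % 2 | m-odd
... | suc _ | _ = refl

Grow-even : ∀ i s → Grow (i + i) s ≡ A i s
Grow-even i s = trans (Grow-A (i + i) s (trans (cong (_% 2) (double i)) (m*n%n≡0 i 2)))
                      (cong (λ k → A k s) (sym (n≡⌊n+n/2⌋ i)))
  where
  double : ∀ i → i + i ≡ i * 2
  double = solve-∀

Grow-odd : ∀ i s → Grow (suc (i + i)) s ≡ B i s
Grow-odd i s = trans (Grow-B (suc (i + i)) s (trans (cong (_% 2) (double+1 i)) ([m+kn]%n≡m%n 1 i 2)))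
                     (cong (λ k → B k s) (sym (n≡⌈n+n/2⌉ i)))
  where
  double+1 : ∀ i → suc (i + i) ≡ 1 + i * 2
  double+1 = solve-∀

even-or-odd : ∀ n → (∃[ i ] n ≡ i + i) ⊎ (∃[ i ] n ≡ suc (i + i))
even-or-odd zero = inj₁ (0 , refl)
even-or-odd (suc n) with even-or-odd n
... | inj₁ (i , refl) = inj₂ (i , refl)
... | inj₂ (i , refl) = inj₁ (suc i , cong suc (sym (+-suc i i)))

Grow≤span : ∀ j s → Grow (suc j + 1) s ≤ span j (s + 4)
Grow≤span j s with even-or-odd j
... | inj₁ (i , refl) = begin
  Grow (suc (i + i) + 1) s  ≡⟨ cong (λ m → Grow m s) (ring i) ⟩
  Grow (suc i + suc i) s    ≡⟨ Grow-even (suc i) s ⟩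
  A (suc i) s               ≤⟨ outgrows⇒≤ {G = A (suc i)} (outgrows-A i) s ⟩
  span (i + i) (s + 4)      ∎
  where
  open ≤-Reasoning
  ring : ∀ i → suc (i + i) + 1 ≡ suc i + suc i
  ring = solve-∀
... | inj₂ (i , refl) = begin
  Grow (suc (suc (i + i)) + 1) s  ≡⟨ cong (λ m → Grow m s) (ring i) ⟩
  Grow (suc (suc i + suc i)) s    ≡⟨ Grow-odd (suc i) s ⟩
  B (suc i) s                     ≤⟨ outgrows⇒≤ {G = B (suc i)} (outgrows-B i) s ⟩
  span (suc (i + i)) (s + 4)      ∎
  where
  open ≤-Reasoning
  ring : ∀ i → suc (suc (i + i)) + 1 ≡ suc (suc i + suc i)
  ring = solve-∀

even≥2 : ∀ {k} → 2 ≤ k → k % 2 ≡ 0 → ∃[ j ] k ≡ 2 * suc j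
even≥2 {k} 2≤k k-even with k / 2 | m≡m%n+[m/n]*n k 2
... | zero  | k≡ = contradiction (subst (2 ≤_) (trans k≡ (cong (_+ 0) k-even)) 2≤k) λ ()
... | suc j | k≡ = j , trans k≡ (trans (cong (_+ suc j * 2) k-even) (*-comm (suc j) 2))

arboricity-mono : ∀ {n} {E : Graph n} {b b′} → b ≤ b′ → Arboricity≤ E b → Arboricity≤ E b′
arboricity-mono b≤b′ arb S F F⊆E 2≤∣S∣ = ≤-trans (arb S F F⊆E 2≤∣S∣) b≤b′

shortcutGraph : ∀ n → ℕ → ℕ → Graph n
shortcutGraph n j S = OutListGraph.graph n (outNbrs j S)

path-shortcut : ∀ n j S → n ≤ span j S →
                IsShortcutting (shortcutGraph n j S) (2 * suc j) × Arboricity≤ (shortcutGraph n j S) (4 * (6 * S))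
path-shortcut n j S n≤span =
  (graph-symmetric , graph-irreflexive ,
   hopDiameter (2 * suc j) (λ a≤b b<n → shortcut-ascent a≤b (<-≤-trans b<n n≤span))) ,
  arboricity-≤ (outNbrs-length j S)
  where
  open OutListGraph n (outNbrs j S)
  open AscentWalks n (outNbrs j S)
  open Shortcut j S

shortcutting : ∀ {n} j s → n ≤ Grow (suc j + 1) s →
               Σ (Graph n) λ E → IsShortcutting E (2 * suc j) × Arboricity≤ E (96 * suc s)
shortcutting {n} j s n≤Grow =
  shortcutGraph n j (s + 4) , proj₁ shortcut , arboricity-mono (24[s+4]≤96[s+1] s) (proj₂ shortcut)
  where
  shortcut : IsShortcutting (shortcutGraph n j (s + 4)) (2 * suc j) ×
             Arboricity≤ (shortcutGraph n j (s + 4)) (4 * (6 * (s + 4)))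
  shortcut = path-shortcut n j (s + 4) (≤-trans n≤Grow (Grow≤span j s))
  24[s+4]≤96[s+1] : ∀ s → 4 * (6 * (s + 4)) ≤ 96 * suc s
  24[s+4]≤96[s+1] s = ≤-trans (m≤m+n _ (72 * s)) (≤-reflexive (ring s))
    where
    ring : ∀ s → 4 * (6 * (s + 4)) + 72 * s ≡ 96 * suc s
    ring = solve-∀

theorem1p4 : Σ ℕ λ C → ∀ (n k : ℕ) → 1 ≤ n → 2 ≤ k → k % 2 ≡ 0 →
    ∀ (s : ℕ) → IsAlpha (k / 2 + 1) n s →
    Σ (Graph n) λ E → IsShortcutting E k × Arboricity≤ E (C * suc s)
theorem1p4 = 96 , construction
  where
  construction : ∀ (n k : ℕ) → 1 ≤ n → 2 ≤ k → k % 2 ≡ 0 →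
                 ∀ (s : ℕ) → IsAlpha (k / 2 + 1) n s →
                 Σ (Graph n) λ E → IsShortcutting E k × Arboricity≤ E (96 * suc s)
  construction n k _ 2≤k k-even s (n≤Grow , _) with even≥2 2≤k k-even
  ... | j , refl = shortcutting j s (subst (λ h → n ≤ Grow (h + 1) s) half n≤Grow)
    where
    half : 2 * suc j / 2 ≡ suc j
    half = trans (cong (_/ 2) (*-comm 2 (suc j))) (m*n/n≡m (suc j) 2)
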